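{- For every odd integer $a>1$, the sequence $(x_n^{(a)})_{n\ge1}$ essentially coincides with $(x_n^{(3)})_{n\ge1}$, i.e. there is $n_0$ such that $x_n^{(a)}=x_n^{(3)}$ for all $n\geq n_0$.
   Context: For a positive integer $m$, let $\nu_2(m)$ be the exponent of the highest power of $2$ dividing $m$. For an odd integer $a>1$ (so $\nu_2(a)=\nu_2(1)=0$), define $x_1^{(a)}=a$ and, for $n\ge2$, $x_n^{(a)}$ is the smallest integer $y>x_{n-1}^{(a)}$ with $\nu_2(y)=\nu_2(n)$. (For example $x^{(3)}$ begins $3,6,7,12,13,14,15,24,\dots$.) -}

module Defs where

open import Data.Nat using (ℕ; zero; suc; _+_; _*_; _^_; _≡ᵇ_; _<_)
open import Data.Nat.DivMod using (_/_; _%_)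
open import Relation.Binary.PropositionalEquality using (_≡_)
open import Data.Bool using (Bool; true; false; if_then_else_)

-- 2-adic valuation with fuel; ν₂-fuel f m is correct whenever f ≥ ν₂ m
-- (in particular for f = m). Convention ν₂ 0 = 0 (never used: all
-- arguments in this development are positive).
ν₂-fuel : ℕ → ℕ → ℕ
ν₂-fuel zero    m = zero
ν₂-fuel (suc f) zero = zero
ν₂-fuel (suc f) m@(suc _) with m % 2 ≡ᵇ 0
... | true  = suc (ν₂-fuel f (m / 2))
... | false = zero

ν₂ : ℕ → ℕ
ν₂ m = ν₂-fuel m m

-- first y among p+1, p+2, ..., p+k (k candidates) with ν₂ y = v;
-- returns p + k + 1 if none (never happens when used below).
search : ℕ → ℕ → ℕ → ℕ
search v p zero    = suc p
search v p (suc k) = if ν₂ (suc p) ≡ᵇ v then suc p else search v (suc p) k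

-- smallest y > p with ν₂ y = v: such y always lies in (p, p + 2^(v+1)],
-- since every window of 2^(v+1) consecutive integers contains one
-- that is ≡ 2^v mod 2^(v+1). Hence the bounded search finds the true minimum.
next : ℕ → ℕ → ℕ
next v p = search v p (2 ^ suc v)

-- x a n = x_n^{(a)} for n ≥ 1; the index 0 is a dummy equal to a.
x : ℕ → ℕ → ℕ
x a zero          = a
x a (suc zero)    = a
x a (suc (suc n)) = next (ν₂ (suc (suc n))) (x a (suc n))

Odd : ℕ → Set
Odd a = a % 2 ≡ 1

module Submission where

-- Write x (2^j) = 2^j + c_j 2^(j+1). Adding a multiple of 2^(j+1) does not change ν₂ of the
-- numbers in (2^j, 2^(j+1)), so x n = n + c_j 2^(j+1) on the whole block [2^j, 2^(j+1)).
-- At n = 2^(j+1) the sequence lands on 2^(j+1)(1 + c_j) if c_j is even, and must skip 2^(j+1)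
-- more if c_j is odd; either way c_(j+1) = ⌈c_j/2⌉. For a = 1 + 2c_0 with c_0 ≥ 1 the c_j reach
-- the fixed point 1, which is where a = 3 starts, and from then on both sequences obey the same
-- recursion.

open import Defs
open import Data.Bool using (true; false)
open import Data.Empty using (⊥-elim)
open import Data.Nat
open import Data.Nat.DivMod
  using (_%_; _/_; [m+kn]%n≡m%n; m*n%n≡0; m*n/n≡m; m≡m%n+[m/n]*n; m≥n⇒m/n>0)
open import Data.Nat.GeneralisedArithmetic using (fold; iterate; iterate-is-fold)
open import Data.Nat.Properties
open import Data.Nat.Tactic.RingSolver using (solve-∀)
open import Data.Product using (∃; _,_)
open import Data.Sum using (inj₁; inj₂)
open import Relation.Binary.PropositionalEquality

data Parity : ℕ → Set where
  even : ∀ q → Parity (q * 2)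
  odd  : ∀ q → Parity (1 + q * 2)

parity-view : ∀ n → Parity n
parity-view zero = even 0
parity-view (suc n) with parity-view n
... | even q = odd q
... | odd q  = even (suc q)

half-< : ∀ {q} w → q * 2 < 2 ^ suc w → q < 2 ^ w
half-< {q} w h = *-cancelʳ-< 2 q (2 ^ w) (subst (q * 2 <_) (*-comm 2 (2 ^ w)) h)

n<2^n : ∀ n → n < 2 ^ n
n<2^n zero    = z<s
n<2^n (suc n) = +-mono-≤ (m^n>0 2 n) (≤-trans (n<2^n n) (m≤m+n (2 ^ n) 0))

⌊n*2/2⌋≡n : ∀ n → ⌊ n * 2 /2⌋ ≡ n
⌊n*2/2⌋≡n zero    = refl
⌊n*2/2⌋≡n (suc n) = cong suc (⌊n*2/2⌋≡n n)

⌈n*2/2⌉≡n : ∀ n → ⌈ n * 2 /2⌉ ≡ n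
⌈n*2/2⌉≡n zero    = refl
⌈n*2/2⌉≡n (suc n) = cong suc (⌈n*2/2⌉≡n n)

iterate-⌈/2⌉≡1 : ∀ k {c} → 0 < c → c ≤ 2 ^ k → iterate ⌈_/2⌉ c k ≡ 1
iterate-⌈/2⌉≡1 zero    0<c c≤1 = ≤-antisym c≤1 0<c
iterate-⌈/2⌉≡1 (suc k) 0<c c≤2^[1+k] =
  iterate-⌈/2⌉≡1 k (⌈n/2⌉-mono 0<c) (≤-trans (⌈n/2⌉-mono c≤2^[1+k]) (≤-reflexive ⌈2^[1+k]/2⌉≡2^k))
  where
  ⌈2^[1+k]/2⌉≡2^k : ⌈ 2 ^ suc k /2⌉ ≡ 2 ^ k
  ⌈2^[1+k]/2⌉≡2^k = trans (cong ⌈_/2⌉ (*-comm 2 (2 ^ k))) (⌈n*2/2⌉≡n (2 ^ k))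

odd⇒n≡1+[n/2]*2 : ∀ {n} → Odd n → n ≡ 1 + n / 2 * 2
odd⇒n≡1+[n/2]*2 {n} n-odd = trans (m≡m%n+[m/n]*n n 2) (cong (_+ n / 2 * 2) n-odd)

ν₂-fuel-odd : ∀ f q → ν₂-fuel (suc f) (1 + q * 2) ≡ 0
ν₂-fuel-odd f q with (1 + q * 2) % 2 | [m+kn]%n≡m%n 1 q 2
... | .1 | refl = refl

ν₂-fuel-double : ∀ f m → ν₂-fuel (suc f) (suc m * 2) ≡ suc (ν₂-fuel f (suc m))
ν₂-fuel-double f m with suc m * 2 % 2 | m*n%n≡0 (suc m) 2
... | .0 | refl = cong (λ k → suc (ν₂-fuel f k)) (m*n/n≡m (suc m) 2)

ν₂-fuel-zero : ∀ f → ν₂-fuel f 0 ≡ 0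
ν₂-fuel-zero zero    = refl
ν₂-fuel-zero (suc f) = refl

ν₂-fuel-stable : ∀ {f g} m → m ≤ f → m ≤ g → ν₂-fuel f m ≡ ν₂-fuel g m
ν₂-fuel-stable m m≤f m≤g with parity-view m
ν₂-fuel-stable {f} {g} _ _ _ | even zero = trans (ν₂-fuel-zero f) (sym (ν₂-fuel-zero g))
ν₂-fuel-stable {suc f} {suc g} _ (s≤s m≤f) (s≤s m≤g) | even (suc q) = begin
  ν₂-fuel (suc f) (suc q * 2)  ≡⟨ ν₂-fuel-double f q ⟩
  suc (ν₂-fuel f (suc q))      ≡⟨ cong suc (ν₂-fuel-stable (suc q) (half≤ m≤f) (half≤ m≤g)) ⟩
  suc (ν₂-fuel g (suc q))      ≡⟨ sym (ν₂-fuel-double g q) ⟩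
  ν₂-fuel (suc g) (suc q * 2)  ∎
  where
  open ≡-Reasoning
  half≤ : ∀ {h} → suc (q * 2) ≤ h → suc q ≤ h
  half≤ = ≤-trans (s≤s (m≤m*n q 2))
ν₂-fuel-stable {suc f} {suc g} _ _ _ | odd q = trans (ν₂-fuel-odd f q) (sym (ν₂-fuel-odd g q))

ν₂-odd : ∀ q → ν₂ (1 + q * 2) ≡ 0
ν₂-odd q = ν₂-fuel-odd (q * 2) q

ν₂-double : ∀ m .{{_ : NonZero m}} → ν₂ (m * 2) ≡ suc (ν₂ m)
ν₂-double (suc m) =
  trans (ν₂-fuel-double (suc (m * 2)) m) (cong suc (ν₂-fuel-stable (suc m) (s≤s (m≤m*n m 2)) ≤-refl))

ν₂-*2^ : ∀ m .{{_ : NonZero m}} v → ν₂ (m * 2 ^ v) ≡ v + ν₂ m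
ν₂-*2^ m zero    = cong ν₂ (*-identityʳ m)
ν₂-*2^ m (suc v) = begin
  ν₂ (m * (2 * 2 ^ v))  ≡⟨ cong ν₂ (*-comm-middle m 2 (2 ^ v)) ⟩
  ν₂ (m * 2 ^ v * 2)    ≡⟨ ν₂-double (m * 2 ^ v) {{m*n≢0 m (2 ^ v)}} ⟩
  suc (ν₂ (m * 2 ^ v))  ≡⟨ cong suc (ν₂-*2^ m v) ⟩
  suc v + ν₂ m          ∎
  where
  open ≡-Reasoning
  instance _ = m^n≢0 2 v
  *-comm-middle : ∀ a b c → a * (b * c) ≡ a * c * b
  *-comm-middle a b c = trans (cong (a *_) (*-comm b c)) (sym (*-assoc a c b))

ν₂-odd*2^ : ∀ q v → ν₂ ((1 + q * 2) * 2 ^ v) ≡ v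
ν₂-odd*2^ q v = trans (ν₂-*2^ (1 + q * 2) v) (trans (cong (v +_) (ν₂-odd q)) (+-identityʳ v))

ν₂-2^ : ∀ v → ν₂ (2 ^ v) ≡ v
ν₂-2^ v = trans (cong ν₂ (sym (*-identityˡ (2 ^ v)))) (ν₂-odd*2^ 0 v)

ν₂-< : ∀ w {r} → 0 < r → r < 2 ^ w → ν₂ r < w
ν₂-< zero    {suc _} _ (s≤s ())
ν₂-< (suc w) {r} 0<r r<2^w with parity-view r
ν₂-< (suc w) () _ | even zero
ν₂-< (suc w) _ r<2^w | even (suc q) =
  subst (_< suc w) (sym (ν₂-double (suc q))) (s<s (ν₂-< w z<s (half-< w r<2^w)))
ν₂-< (suc w) _ _ | odd q = subst (_< suc w) (sym (ν₂-odd q)) z<s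

ν₂-+-*2^ : ∀ w {r} c → 0 < r → r < 2 ^ w → ν₂ (r + c * 2 ^ w) ≡ ν₂ r
ν₂-+-*2^ zero    {suc _} _ _ (s≤s ())
ν₂-+-*2^ (suc w) {r} c 0<r r<2^w with parity-view r
ν₂-+-*2^ (suc w) c () _ | even zero
ν₂-+-*2^ (suc w) c _ r<2^w | even (suc q) = begin
  ν₂ (suc q * 2 + c * 2 ^ suc w)  ≡⟨ cong ν₂ (even-+ (suc q) c (2 ^ w)) ⟩
  ν₂ ((suc q + c * 2 ^ w) * 2)    ≡⟨ ν₂-double (suc q + c * 2 ^ w) ⟩
  suc (ν₂ (suc q + c * 2 ^ w))    ≡⟨ cong suc (ν₂-+-*2^ w c z<s (half-< w r<2^w)) ⟩
  suc (ν₂ (suc q))                ≡⟨ sym (ν₂-double (suc q)) ⟩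
  ν₂ (suc q * 2)                  ∎
  where
  open ≡-Reasoning
  even-+ : ∀ q c P → q * 2 + c * (2 * P) ≡ (q + c * P) * 2
  even-+ = solve-∀
ν₂-+-*2^ (suc w) c _ _ | odd q = begin
  ν₂ (1 + q * 2 + c * 2 ^ suc w)    ≡⟨ cong ν₂ (odd-+ q c (2 ^ w)) ⟩
  ν₂ (1 + (q + c * 2 ^ w) * 2)      ≡⟨ ν₂-odd (q + c * 2 ^ w) ⟩
  0                                 ≡⟨ sym (ν₂-odd q) ⟩
  ν₂ (1 + q * 2)                    ∎
  where
  open ≡-Reasoning
  odd-+ : ∀ q c P → 1 + q * 2 + c * (2 * P) ≡ 1 + (q + c * P) * 2
  odd-+ = solve-∀

ν₂≢-lower-half : ∀ w m {i} → i < 2 ^ w → ν₂ (i + suc m * 2 ^ suc w) ≢ w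
ν₂≢-lower-half w m {zero} _ eq =
  <⇒≢ (s≤s (m≤m+n w (ν₂ (suc m)))) (sym (trans (sym (ν₂-*2^ (suc m) (suc w))) eq))
ν₂≢-lower-half w m {suc i} 1+i<2^w eq =
  <⇒≢ (ν₂-< w z<s 1+i<2^w) (trans (sym (ν₂-+-*2^ (suc w) (suc m) z<s 1+i<2^[1+w])) eq)
  where
  1+i<2^[1+w] : suc i < 2 ^ suc w
  1+i<2^[1+w] = <-≤-trans 1+i<2^w (m≤m+n (2 ^ w) (2 ^ w + 0))

search-hit : ∀ {v p} k → ν₂ (suc p) ≡ v → search v p (suc k) ≡ suc p
search-hit {v} {p} k hit with ν₂ (suc p) ≡ᵇ v | ≡⇒≡ᵇ (ν₂ (suc p)) v hit
... | true  | _  = refl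
... | false | ()

search-miss : ∀ {v p} k → ν₂ (suc p) ≢ v → search v p (suc k) ≡ search v (suc p) k
search-miss {v} {p} k miss with ν₂ (suc p) ≡ᵇ v | ≡ᵇ⇒≡ (ν₂ (suc p)) v
... | false | _   = refl
... | true  | hit = ⊥-elim (miss (hit _))

search-first : ∀ k {v p q} → p < q → q ≤ p + k → ν₂ q ≡ v →
               (∀ {y} → p < y → y < q → ν₂ y ≢ v) → search v p k ≡ q
search-first zero {p = p} p<q q≤p+0 _ _ = ⊥-elim (<⇒≱ p<q (subst (_ ≤_) (+-identityʳ p) q≤p+0))
search-first (suc k) {p = p} {q} p<q q≤p+1+k hit before with m≤n⇒m<n∨m≡n p<q
... | inj₂ refl   = search-hit k hit
... | inj₁ 1+p<q  = trans (search-miss k (before ≤-refl 1+p<q))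
  (search-first k 1+p<q (subst (q ≤_) (+-suc p k) q≤p+1+k) hit
    (λ 1+p<y → before (<-trans (n<1+n p) 1+p<y)))

next-≡ : ∀ {v p q} → p < q → q ≤ p + 2 ^ suc v → ν₂ q ≡ v →
         (∀ {y} → p < y → y < q → ν₂ y ≢ v) → next v p ≡ q
next-≡ = search-first _

next-hit : ∀ {v p} → ν₂ (suc p) ≡ v → next v p ≡ suc p
next-hit {v} {p} hit =
  next-≡ ≤-refl (m<m+n p (m^n>0 2 (suc v))) hit (λ p<y y<1+p _ → <⇒≱ p<y (≤-pred y<1+p))

next-skip : ∀ w m p → suc p ≡ suc m * 2 ^ suc w → next w p ≡ suc p + 2 ^ w
next-skip w m p 1+p≡ = next-≡ (s≤s (m≤m+n p (2 ^ w))) in-window hit before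
  where
  in-window : suc p + 2 ^ w ≤ p + 2 ^ suc w
  in-window = subst (_≤ p + 2 ^ suc w) (+-suc p (2 ^ w))
    (+-monoʳ-≤ p (m<m+n (2 ^ w) (<-≤-trans (m^n>0 2 w) (m≤m+n (2 ^ w) 0))))
  hit : ν₂ (suc p + 2 ^ w) ≡ w
  hit = trans (cong ν₂ (trans (cong (_+ 2 ^ w) 1+p≡) (odd-block m (2 ^ w)))) (ν₂-odd*2^ (suc m) w)
    where
    odd-block : ∀ m X → suc m * (2 * X) + X ≡ (1 + suc m * 2) * X
    odd-block = solve-∀
  before : ∀ {y} → p < y → y < suc p + 2 ^ w → ν₂ y ≢ w
  before {y} p<y y< with m≤n⇒∃[o]m+o≡n p<y
  ... | i , refl = subst (λ z → ν₂ z ≢ w) (trans (+-comm i _) (cong (_+ i) (sym 1+p≡)))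
                     (ν₂≢-lower-half w m (+-cancelˡ-< (suc p) i (2 ^ w) y<))

next-after-multiple : ∀ w c {p} → suc p ≡ 2 ^ w + c * 2 ^ w →
                      next w p ≡ 2 ^ w + ⌈ c /2⌉ * 2 ^ suc w
next-after-multiple w c {p} 1+p≡ with parity-view c
... | even q = begin
  next w p                   ≡⟨ next-hit (trans (cong ν₂ (trans 1+p≡ (even-q (2 ^ w) q))) (ν₂-odd*2^ q w)) ⟩
  suc p                      ≡⟨ 1+p≡ ⟩
  2 ^ w + q * 2 * 2 ^ w      ≡⟨ even-half (2 ^ w) q ⟩
  2 ^ w + q * 2 ^ suc w      ≡⟨ cong (λ d → 2 ^ w + d * 2 ^ suc w) (sym (⌈n*2/2⌉≡n q)) ⟩
  2 ^ w + ⌈ q * 2 /2⌉ * 2 ^ suc w ∎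
  where
  open ≡-Reasoning
  even-q : ∀ X q → X + q * 2 * X ≡ (1 + q * 2) * X
  even-q = solve-∀
  even-half : ∀ X q → X + q * 2 * X ≡ X + q * (2 * X)
  even-half = solve-∀
... | odd q = begin
  next w p                       ≡⟨ next-skip w q p (trans 1+p≡ (odd-q (2 ^ w) q)) ⟩
  suc p + 2 ^ w                  ≡⟨ cong (_+ 2 ^ w) 1+p≡ ⟩
  2 ^ w + (1 + q * 2) * 2 ^ w + 2 ^ w ≡⟨ odd-half (2 ^ w) q ⟩
  2 ^ w + suc q * 2 ^ suc w      ≡⟨ cong (λ d → 2 ^ w + d * 2 ^ suc w) (sym (⌊n*2/2⌋≡n (suc q))) ⟩
  2 ^ w + ⌈ 1 + q * 2 /2⌉ * 2 ^ suc w ∎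
  where
  open ≡-Reasoning
  odd-q : ∀ X q → X + (1 + q * 2) * X ≡ suc q * (2 * X)
  odd-q = solve-∀
  odd-half : ∀ X q → X + (1 + q * 2) * X + X ≡ X + suc q * (2 * X)
  odd-half = solve-∀

x-suc : ∀ a {n} → 0 < n → x a (suc n) ≡ next (ν₂ (suc n)) (x a n)
x-suc a {suc n} _ = refl

x-agree : ∀ a b {m n} → 0 < m → m ≤′ n → x a m ≡ x b m → x a n ≡ x b n
x-agree a b 0<m ≤′-refl xm = xm
x-agree a b {m} {suc n} 0<m (≤′-step m≤′n) xm = begin
  x a (suc n)                ≡⟨ x-suc a 0<n ⟩
  next (ν₂ (suc n)) (x a n)  ≡⟨ cong (next (ν₂ (suc n))) (x-agree a b 0<m m≤′n xm) ⟩
  next (ν₂ (suc n)) (x b n)  ≡⟨ sym (x-suc b 0<n) ⟩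
  x b (suc n)                ∎
  where
  open ≡-Reasoning
  0<n : 0 < n
  0<n = <-≤-trans 0<m (≤′⇒≤ m≤′n)

x-offset-persists : ∀ a w c {m n} → 0 < m → m ≤′ n → n < 2 ^ w →
                    x a m ≡ m + c * 2 ^ w → x a n ≡ n + c * 2 ^ w
x-offset-persists a w c 0<m ≤′-refl _ xm = xm
x-offset-persists a w c {m} {suc n} 0<m (≤′-step m≤′n) 1+n<2^w xm = begin
  x a (suc n)                        ≡⟨ x-suc a 0<n ⟩
  next (ν₂ (suc n)) (x a n)          ≡⟨ cong (next (ν₂ (suc n)))
                                          (x-offset-persists a w c 0<m m≤′n (<-trans (n<1+n n) 1+n<2^w) xm) ⟩
  next (ν₂ (suc n)) (n + c * 2 ^ w)  ≡⟨ next-hit (ν₂-+-*2^ w c z<s 1+n<2^w) ⟩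
  suc n + c * 2 ^ w                  ∎
  where
  open ≡-Reasoning
  0<n : 0 < n
  0<n = <-≤-trans 0<m (≤′⇒≤ m≤′n)

x-double : ∀ a j c → x a (2 ^ j) ≡ 2 ^ j + c * 2 ^ suc j →
           x a (2 ^ suc j) ≡ 2 ^ suc j + ⌈ c /2⌉ * 2 ^ suc (suc j)
x-double a j c x2^j = begin
  x a T                           ≡⟨ cong (x a) (sym 1+n≡T) ⟩
  x a (suc n)                     ≡⟨ x-suc a (<-≤-trans (m^n>0 2 j) 2^j≤n) ⟩
  next (ν₂ (suc n)) (x a n)       ≡⟨ cong₂ next (trans (cong ν₂ 1+n≡T) (ν₂-2^ (suc j)))
                                      (x-offset-persists a (suc j) c (m^n>0 2 j) (≤⇒≤′ 2^j≤n) n<T x2^j) ⟩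
  next (suc j) (n + c * T)        ≡⟨ next-after-multiple (suc j) c (cong (_+ c * T) 1+n≡T) ⟩
  T + ⌈ c /2⌉ * 2 ^ suc (suc j)   ∎
  where
  open ≡-Reasoning
  T = 2 ^ suc j
  instance _ = m^n≢0 2 (suc j)
  n = pred T
  1+n≡T : suc n ≡ T
  1+n≡T = suc-pred T
  n<T : n < T
  n<T = subst (n <_) 1+n≡T ≤-refl
  2^j<T : 2 ^ j < T
  2^j<T = m<m+n (2 ^ j) (<-≤-trans (m^n>0 2 j) (m≤m+n (2 ^ j) 0))
  2^j≤n : 2 ^ j ≤ n
  2^j≤n = ≤-pred (subst (2 ^ j <_) (sym 1+n≡T) 2^j<T)

x-2^ : ∀ a c → x a 1 ≡ 1 + c * 2 → ∀ j → x a (2 ^ j) ≡ 2 ^ j + fold c ⌈_/2⌉ j * 2 ^ suc j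
x-2^ a c x1 zero    = x1
x-2^ a c x1 (suc j) = x-double a j (fold c ⌈_/2⌉ j) (x-2^ a c x1 j)

x-2^-eventually : ∀ a c j → x a 1 ≡ 1 + c * 2 → 0 < c → c ≤ 2 ^ j →
                  x a (2 ^ j) ≡ 2 ^ j + 2 ^ suc j
x-2^-eventually a c j x1 0<c c≤2^j = begin
  x a (2 ^ j)                            ≡⟨ x-2^ a c x1 j ⟩
  2 ^ j + fold c ⌈_/2⌉ j * 2 ^ suc j     ≡⟨ cong (λ d → 2 ^ j + d * 2 ^ suc j) (iterate-is-fold c ⌈_/2⌉ j) ⟩
  2 ^ j + iterate ⌈_/2⌉ c j * 2 ^ suc j  ≡⟨ cong (λ d → 2 ^ j + d * 2 ^ suc j) (iterate-⌈/2⌉≡1 j 0<c c≤2^j) ⟩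
  2 ^ j + 1 * 2 ^ suc j                  ≡⟨ cong (2 ^ j +_) (*-identityˡ (2 ^ suc j)) ⟩
  2 ^ j + 2 ^ suc j                      ∎
  where open ≡-Reasoning

theorem2 : (a : ℕ) → Odd a → 1 < a →
    ∃ λ n₀ → (n : ℕ) → n₀ ≤ n → x a n ≡ x 3 n
theorem2 a a-odd 1<a = 2 ^ c , λ n 2^c≤n → x-agree a 3 (m^n>0 2 c) (≤⇒≤′ 2^c≤n) x2^c≡x3
  where
  c = a / 2
  x2^c≡x3 : x a (2 ^ c) ≡ x 3 (2 ^ c)
  x2^c≡x3 = trans (x-2^-eventually a c c (odd⇒n≡1+[n/2]*2 a-odd) (m≥n⇒m/n>0 1<a) (<⇒≤ (n<2^n c)))
                  (sym (x-2^-eventually 3 1 c refl z<s (m^n>0 2 c)))
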